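{- Let $\mathcal{A}$ be an Abelian group, $\Phi$ an injective endomorphism of $\mathcal{A}$, $w\ge1$ an integer, $\mathcal{D}^\bullet$ a system of representatives of those residue classes of $\mathcal{A}$ modulo $\Phi^w(\mathcal{A})$ which are not contained in $\Phi(\mathcal{A})$, and $\mathcal{D}=\mathcal{D}^\bullet\cup\{0\}$. Define $d\colon\mathcal{A}\to\mathcal{D}$ by $d(\alpha)=0$ if $\alpha\in\Phi(\mathcal{A})$ and $d(\alpha)$ the unique element of $\mathcal{D}^\bullet$ with $d(\alpha)\equiv\alpha\pmod{\Phi^w(\mathcal{A})}$ otherwise, and $T\colon\mathcal{A}\to\mathcal{A}$ by $T(\alpha)=\Phi^{ -1}(\alpha-d(\alpha))$. Let $\alpha\in\mathcal{A}$ and $\ell\ge0$. Then $\alpha$ has a $\mathcal{D}$-$w$-NAF $\eta_{\ell-1}\ldots\eta_0$ (of length $\ell$) if and only if $T^\ell(\alpha)=0$; in this case $\eta_k=d(T^k(\alpha))$ for $0\le k<\ell$. In particular, the $\mathcal{D}$-$w$-NAF of an $\alpha\in\mathcal{A}$, if it exists, is unique up to leading zeros.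
   Context: A word $\eta_{\ell-1}\ldots\eta_0$ over the alphabet $\mathcal{D}$ is a $\mathcal{D}$-$w$-NAF if every factor $\eta_{j+w-1}\ldots\eta_j$, $0\le j\le\ell-w$, contains at most one non-zero letter; its value is $\sum_{j=0}^{\ell-1}\Phi^j(\eta_j)$ (the empty word has value $0$), and it is a $\mathcal{D}$-$w$-NAF of $\alpha$ if its value is $\alpha$. The map $T$ is well defined since $\alpha-d(\alpha)\in\Phi(\mathcal{A})$ and $\Phi$ is injective. -}

module Defs where

open import Level using (Level; _⊔_)
open import Algebra.Bundles using (AbelianGroup)
open import Algebra.Morphism.Structures using (module GroupMorphisms)
open import Data.Nat using (ℕ; zero; suc; _+_; _<_; _≤_)
open import Data.Fin using (Fin; toℕ; fromℕ<)
import Data.Fin as Fin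
open import Data.Product using (Σ; _×_)
open import Data.Sum using (_⊎_)
open import Relation.Nullary using (¬_)
open import Data.Empty using (⊥)

iter : ∀ {a} {A : Set a} → ℕ → (A → A) → A → A
iter zero    f x = x
iter (suc n) f x = f (iter n f x)

-- Everything is relative to an abelian group 𝒜 written multiplicatively in the
-- stdlib: _∙_ is the group addition, ε is 0, _⁻¹ is negation.
module Setup {c ℓ : Level} (G : AbelianGroup c ℓ) where
  open AbelianGroup G renaming (Carrier to A)

  IsInjectiveEndo : (A → A) → Set (c ⊔ ℓ)
  IsInjectiveEndo Φ = GroupMorphisms.IsGroupMonomorphism rawGroup rawGroup Φ

  _∈Im_ : A → (A → A) → Set (c ⊔ ℓ)
  x ∈Im f = Σ A (λ y → f y ≈ x)

  Cong : (Φ : A → A) (w : ℕ) → A → A → Set (c ⊔ ℓ)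
  Cong Φ w x y = (x - y) ∈Im iter w Φ

  ClassNotInΦ : (Φ : A → A) (w : ℕ) → A → Set (c ⊔ ℓ)
  ClassNotInΦ Φ w x = ¬ (∀ y → Cong Φ w y x → y ∈Im Φ)

  record IsRepSystem {p : Level} (Φ : A → A) (w : ℕ) (D• : A → Set p)
         : Set (c ⊔ ℓ ⊔ p) where
    field
      rep-class  : ∀ δ → D• δ → ClassNotInΦ Φ w δ
      rep-exists : ∀ x → ClassNotInΦ Φ w x → Σ A (λ δ → D• δ × Cong Φ w δ x)
      rep-unique : ∀ δ δ′ → D• δ → D• δ′ → Cong Φ w δ δ′ → δ ≈ δ′

  InD : ∀ {p} → (A → Set p) → A → Set (ℓ ⊔ p)
  InD D• η = (η ≈ ε) ⊎ D• η

  IsDigitMap : ∀ {p} (Φ : A → A) (w : ℕ) (D• : A → Set p) (d : A → A)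
               → Set (c ⊔ ℓ ⊔ p)
  IsDigitMap Φ w D• d = ∀ α →
      (α ∈Im Φ × d α ≈ ε)
    ⊎ ((¬ (α ∈Im Φ)) × (D• (d α) × Cong Φ w (d α) α))

  -- T(α) = Φ⁻¹(α - d(α)), i.e. the (unique, Φ injective) element with
  -- Φ(T α) = α - d α
  IsTMap : (Φ : A → A) (d : A → A) (T : A → A) → Set (c ⊔ ℓ)
  IsTMap Φ d T = ∀ α → Φ (T α) ≈ α - d α

  sumFin : (n : ℕ) → (Fin n → A) → A
  sumFin zero    f = ε
  sumFin (suc n) f = f Fin.zero ∙ sumFin n (λ j → f (Fin.suc j))

  -- a word η_{L-1} … η_0 is represented as η : Fin L → A (η j = η_j);
  -- its value is Σ_{j<L} Φ^j(η_j)
  value : (Φ : A → A) (L : ℕ) → (Fin L → A) → A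
  value Φ L η = sumFin L (λ j → iter (toℕ j) Φ (η j))

  -- w-NAF condition: any w consecutive letters (word padded by leading zeros)
  -- contain at most one non-zero letter, i.e. two distinct positions
  -- i < k with k < i + w are never both non-zero
  IsWNAFWord : (w L : ℕ) → (Fin L → A) → Set ℓ
  IsWNAFWord w L η = ∀ (i k : Fin L) → toℕ i < toℕ k → toℕ k < toℕ i + w
                     → ¬ (η i ≈ ε) → ¬ (η k ≈ ε) → ⊥

  IsNAFof : ∀ {p} (Φ : A → A) (w : ℕ) (D• : A → Set p)
            (L : ℕ) → (Fin L → A) → A → Set (ℓ ⊔ p)
  IsNAFof Φ w D• L η α =
    (∀ j → InD D• (η j)) × IsWNAFWord w L η × (value Φ L η ≈ α)

  padded : (L : ℕ) → (Fin L → A) → ℕ → A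
  padded zero    η k       = ε
  padded (suc L) η zero    = η Fin.zero
  padded (suc L) η (suc k) = padded L (λ j → η (Fin.suc j)) k

-- The leading digit of a w-NAF of α is forced: if it is non-zero, the next
-- w − 1 digits vanish, so α is congruent to it modulo Φʷ(𝒜) and α ∉ Φ(𝒜);
-- hence it is the representative d(α). If it is zero, then α ∈ Φ(𝒜) and
-- d(α) = 0 as well. Either way the remaining digits form a w-NAF of T(α),
-- and induction gives ηₖ = d(Tᵏ α) and Tᴸ α = 0. Conversely the digits
-- d(Tᵏ α) always form a w-NAF: after a non-zero digit d(β) we have
-- β − d(β) ∈ Φʷ(𝒜), so Tʲ⁺¹ β ∈ Φ(𝒜) and d(Tʲ⁺¹ β) = 0 for j < w − 1.
module Submission where

open import Defs
open import Level using (Level)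
open import Algebra.Bundles using (AbelianGroup)
open import Data.Nat using (ℕ; _≤_; _<_)
open import Data.Fin using (Fin; toℕ)
open import Data.Product using (Σ; _×_)
open import Function.Bundles using (_⇔_)

open import Algebra.Morphism.Structures using (module GroupMorphisms)
import Algebra.Morphism.Construct.Composition as Composition
import Algebra.Morphism.Construct.Identity as Identity
import Algebra.Properties.AbelianGroup as AbelianGroupProperties
import Algebra.Properties.Group as GroupProperties
open import Data.Nat using (zero; suc; z≤n; s≤s; _+_)
open import Data.Nat.Properties using (+-suc; +-identityʳ; m≤n⇒∃[o]m+o≡n)
import Data.Fin as Fin
open import Data.Product using (_,_)
open import Data.Sum using (inj₁; inj₂)
open import Data.Empty using (⊥-elim)
open import Relation.Nullary using (¬_)
open import Function.Bundles using (mk⇔)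
open import Relation.Binary.PropositionalEquality as ≡ using (_≡_)
import Relation.Binary.Reasoning.Setoid as SetoidReasoning

iter-suc : ∀ {a} {A : Set a} (f : A → A) k x → iter k f (f x) ≡ iter (suc k) f x
iter-suc f zero    x = ≡.refl
iter-suc f (suc k) x = ≡.cong f (iter-suc f k x)

iter-+ : ∀ {a} {A : Set a} (f : A → A) m n x → iter (m + n) f x ≡ iter m f (iter n f x)
iter-+ f zero    n x = ≡.refl
iter-+ f (suc m) n x = ≡.cong f (iter-+ f m n x)

m<n<m+1+o⇒∃[j]n≡1+j+m×j<o : ∀ m n o → m < n → n < m + suc o
                            → Σ ℕ (λ j → (n ≡ suc j + m) × (j < o))
m<n<m+1+o⇒∃[j]n≡1+j+m×j<o zero    (suc n) o _ (s≤s n<o) =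
  n , ≡.cong suc (≡.sym (+-identityʳ n)) , n<o
m<n<m+1+o⇒∃[j]n≡1+j+m×j<o (suc m) (suc n) o (s≤s m<n) (s≤s n<m+1+o)
  with m<n<m+1+o⇒∃[j]n≡1+j+m×j<o m n o m<n n<m+1+o
... | j , n≡1+j+m , j<o = j , ≡.cong suc (≡.trans n≡1+j+m (≡.sym (+-suc j m))) , j<o

module _ {c ℓ : Level} (G : AbelianGroup c ℓ) where
  open AbelianGroup G renaming (Carrier to A)
  open Setup G
  open GroupMorphisms rawGroup rawGroup
  open AbelianGroupProperties G using (xyx⁻¹≈y; ⁻¹-anti-homo‿-)
  open GroupProperties group using (//-rightDividesˡ; ε⁻¹≈ε)
  open SetoidReasoning setoid

  iter-isGroupHomomorphism : ∀ {f} → IsGroupHomomorphism f → ∀ n → IsGroupHomomorphism (iter n f)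
  iter-isGroupHomomorphism f-homo zero    = Identity.isGroupHomomorphism rawGroup refl
  iter-isGroupHomomorphism f-homo (suc n) =
    Composition.isGroupHomomorphism trans (iter-isGroupHomomorphism f-homo n) f-homo

  ∈Im-iter-suc⇒∈Im : ∀ {f x} n → x ∈Im iter (suc n) f → x ∈Im f
  ∈Im-iter-suc⇒∈Im {f} n (u , fⁿ⁺¹u≈x) = iter n f u , fⁿ⁺¹u≈x

  ∈Im-resp : ∀ {f x y} → x ≈ y → x ∈Im f → y ∈Im f
  ∈Im-resp x≈y (u , fu≈x) = u , trans fu≈x x≈y

  x-ε≈x : ∀ x → x - ε ≈ x
  x-ε≈x x = trans (∙-congˡ ε⁻¹≈ε) (identityʳ x)

  x∙[y-x]≈y : ∀ x y → x ∙ (y - x) ≈ y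
  x∙[y-x]≈y x y = trans (sym (assoc x y (x ⁻¹))) (xyx⁻¹≈y x y)

  module Subgroup {f : A → A} (f-homo : IsGroupHomomorphism f) where
    open IsGroupHomomorphism f-homo

    ε∈Im : ε ∈Im f
    ε∈Im = ε , ε-homo

    ∙-∈Im : ∀ {x y} → x ∈Im f → y ∈Im f → (x ∙ y) ∈Im f
    ∙-∈Im (u , fu≈x) (v , fv≈y) = u ∙ v , trans (homo u v) (∙-cong fu≈x fv≈y)

    ⁻¹-∈Im : ∀ {x} → x ∈Im f → (x ⁻¹) ∈Im f
    ⁻¹-∈Im (u , fu≈x) = u ⁻¹ , trans (⁻¹-homo u) (⁻¹-cong fu≈x)

    -‿sym-∈Im : ∀ {x y} → (x - y) ∈Im f → (y - x) ∈Im f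
    -‿sym-∈Im {x} {y} x-y = ∈Im-resp (⁻¹-anti-homo‿- x y) (⁻¹-∈Im x-y)

    -‿trans-∈Im : ∀ {x y z} → (x - y) ∈Im f → (y - z) ∈Im f → (x - z) ∈Im f
    -‿trans-∈Im {x} {y} {z} x-y y-z = ∈Im-resp x-y∙y-z≈x-z (∙-∈Im x-y y-z)
      where
      x-y∙y-z≈x-z : (x - y) ∙ (y - z) ≈ x - z
      x-y∙y-z≈x-z = begin
        (x - y) ∙ (y - z)    ≈⟨ assoc x (y ⁻¹) (y - z) ⟩
        x ∙ (y ⁻¹ ∙ (y - z)) ≈⟨ ∙-congˡ (sym (assoc (y ⁻¹) y (z ⁻¹))) ⟩
        x ∙ (y ⁻¹ ∙ y - z)   ≈⟨ ∙-congˡ (∙-congʳ (inverseˡ y)) ⟩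
        x ∙ (ε - z)          ≈⟨ ∙-congˡ (identityˡ (z ⁻¹)) ⟩
        x - z                ∎

    ∈Im-resp-≡mod : ∀ {x y} → (x - y) ∈Im f → y ∈Im f → x ∈Im f
    ∈Im-resp-≡mod {x} {y} x-y y∈ = ∈Im-resp (//-rightDividesˡ y x) (∙-∈Im x-y y∈)

    sumFin-homo : ∀ L (g : Fin L → A) → sumFin L (λ j → f (g j)) ≈ f (sumFin L g)
    sumFin-homo zero    g = sym ε-homo
    sumFin-homo (suc L) g = trans (∙-congˡ (sumFin-homo L (λ j → g (Fin.suc j)))) (sym (homo _ _))

  sumFin-cong : ∀ L {g h : Fin L → A} → (∀ j → g j ≈ h j) → sumFin L g ≈ sumFin L h
  sumFin-cong zero    g≈h = refl
  sumFin-cong (suc L) g≈h = ∙-cong (g≈h Fin.zero) (sumFin-cong L (λ j → g≈h (Fin.suc j)))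

  padded-toℕ : ∀ L (η : Fin L → A) k → padded L η (toℕ k) ≡ η k
  padded-toℕ (suc L) η Fin.zero    = ≡.refl
  padded-toℕ (suc L) η (Fin.suc k) = padded-toℕ L (λ j → η (Fin.suc j)) k

  module NAFExpansion
    {p : Level} (Φ : A → A) (Φ-mono : IsInjectiveEndo Φ) (w′ : ℕ)
    (D• : A → Set p) (rep : IsRepSystem Φ (suc w′) D•)
    (d : A → A) (d-digit : IsDigitMap Φ (suc w′) D• d)
    (T : A → A) (T-def : IsTMap Φ d T)
    where

    open IsGroupMonomorphism Φ-mono
    open IsRepSystem rep

    w : ℕ
    w = suc w′

    module ImΦ = Subgroup isGroupHomomorphism
    module ImΦʷ = Subgroup (iter-isGroupHomomorphism isGroupHomomorphism w)

    iter-Φ-cong : ∀ n {x y} → x ≈ y → iter n Φ x ≈ iter n Φ y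
    iter-Φ-cong n = IsGroupHomomorphism.⟦⟧-cong (iter-isGroupHomomorphism isGroupHomomorphism n)

    ≡modΦʷ⇒≡modΦ : ∀ {x y} → Cong Φ w x y → (x - y) ∈Im Φ
    ≡modΦʷ⇒≡modΦ = ∈Im-iter-suc⇒∈Im w′

    D•⇒∉ImΦ : ∀ {δ} → D• δ → ¬ (δ ∈Im Φ)
    D•⇒∉ImΦ {δ} δ∈D• δ∈ImΦ =
      rep-class δ δ∈D• (λ y y≡δ → ImΦ.∈Im-resp-≡mod (≡modΦʷ⇒≡modΦ y≡δ) δ∈ImΦ)

    D•⇒≉ε : ∀ {δ} → D• δ → ¬ (δ ≈ ε)
    D•⇒≉ε δ∈D• δ≈ε = D•⇒∉ImΦ δ∈D• (∈Im-resp (sym δ≈ε) ImΦ.ε∈Im)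

    d-∈D : ∀ α → InD D• (d α)
    d-∈D α with d-digit α
    ... | inj₁ (_ , dα≈ε)      = inj₁ dα≈ε
    ... | inj₂ (_ , dα∈D• , _) = inj₂ dα∈D•

    d-∈ImΦ : ∀ {α} → α ∈Im Φ → d α ≈ ε
    d-∈ImΦ {α} α∈ImΦ with d-digit α
    ... | inj₁ (_ , dα≈ε) = dα≈ε
    ... | inj₂ (α∉ImΦ , _) = ⊥-elim (α∉ImΦ α∈ImΦ)

    d-≡mod-D• : ∀ {α δ} → D• δ → Cong Φ w α δ → d α ≈ δ
    d-≡mod-D• {α} {δ} δ∈D• α≡δ with d-digit α
    ... | inj₁ (α∈ImΦ , _) =
      ⊥-elim (D•⇒∉ImΦ δ∈D• (ImΦ.∈Im-resp-≡mod (≡modΦʷ⇒≡modΦ (ImΦʷ.-‿sym-∈Im α≡δ)) α∈ImΦ))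
    ... | inj₂ (_ , dα∈D• , dα≡α) = rep-unique (d α) δ dα∈D• δ∈D• (ImΦʷ.-‿trans-∈Im dα≡α α≡δ)

    T-unique : ∀ {α β} → Φ β ≈ α - d α → T α ≈ β
    T-unique {α} Φβ≈α-dα = injective (trans (T-def α) (sym Φβ≈α-dα))

    T-∈ImΦ : ∀ {α β} → Φ β ≈ α → T α ≈ β
    T-∈ImΦ {α} {β} Φβ≈α = T-unique (begin
      Φ β       ≈⟨ Φβ≈α ⟩
      α         ≈⟨ x-ε≈x α ⟨
      α - ε     ≈⟨ ∙-congˡ (⁻¹-cong (d-∈ImΦ (β , Φβ≈α))) ⟨
      α - d α   ∎)

    iterT-ε : ∀ {x} → x ≈ ε → ∀ k → iter k T x ≈ ε
    iterT-ε x≈ε zero    = x≈ε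
    iterT-ε x≈ε (suc k) = T-∈ImΦ (trans ε-homo (sym (iterT-ε x≈ε k)))

    iterT-∈Im-iter : ∀ j n {γ} → γ ∈Im iter (j + n) Φ → iter j T γ ∈Im iter n Φ
    iterT-∈Im-iter zero    n γ∈ = γ∈
    iterT-∈Im-iter (suc j) n {γ} γ∈
      with iterT-∈Im-iter j (suc n) (≡.subst (λ m → γ ∈Im iter m Φ) (≡.sym (+-suc j n)) γ∈)
    ... | u , Φⁿ⁺¹u≈Tʲγ = u , sym (T-∈ImΦ Φⁿ⁺¹u≈Tʲγ)

    tail : ∀ {L} → (Fin (suc L) → A) → Fin L → A
    tail η j = η (Fin.suc j)

    value-cong : ∀ L {η η′ : Fin L → A} → (∀ j → η j ≈ η′ j) → value Φ L η ≈ value Φ L η′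
    value-cong L η≈η′ = sumFin-cong L (λ j → iter-Φ-cong (toℕ j) (η≈η′ j))

    value-suc : ∀ L (η : Fin (suc L) → A) → value Φ (suc L) η ≈ η Fin.zero ∙ Φ (value Φ L (tail η))
    value-suc L η = ∙-congˡ (ImΦ.sumFin-homo L (λ j → iter (toℕ j) Φ (η (Fin.suc j))))

    value-∈Im-iter : ∀ L m (η : Fin L → A) → (∀ j → toℕ j < m → η j ≈ ε) → value Φ L η ∈Im iter m Φ
    value-∈Im-iter L       zero    η _     = value Φ L η , refl
    value-∈Im-iter zero    (suc m) η _     =
      Subgroup.ε∈Im (iter-isGroupHomomorphism isGroupHomomorphism (suc m))
    value-∈Im-iter (suc L) (suc m) η η≈ε
      with value-∈Im-iter L m (tail η) (λ j j<m → η≈ε (Fin.suc j) (s≤s j<m))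
    ... | u , Φᵐu≈v = u , (begin
      Φ (iter m Φ u)                         ≈⟨ ⟦⟧-cong Φᵐu≈v ⟩
      Φ (value Φ L (tail η))                 ≈⟨ identityˡ _ ⟨
      ε ∙ Φ (value Φ L (tail η))             ≈⟨ ∙-congʳ (η≈ε Fin.zero (s≤s z≤n)) ⟨
      η Fin.zero ∙ Φ (value Φ L (tail η))    ≈⟨ value-suc L η ⟨
      value Φ (suc L) η                      ∎)

    value-tail : ∀ {L α} (η : Fin (suc L) → A) → value Φ (suc L) η ≈ α
                 → Φ (value Φ L (tail η)) ≈ α - η Fin.zero
    value-tail {L} {α} η val≈α = begin
      Φ (value Φ L (tail η))                           ≈⟨ xyx⁻¹≈y (η Fin.zero) _ ⟨
      η Fin.zero ∙ Φ (value Φ L (tail η)) - η Fin.zero ≈⟨ ∙-congʳ (trans (sym (value-suc L η)) val≈α) ⟩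
      α - η Fin.zero                                   ∎

    NAF-head≈d : ∀ {L α} {η : Fin (suc L) → A} → IsNAFof Φ w D• (suc L) η α → η Fin.zero ≈ d α
    NAF-head≈d {L} {α} {η} (η∈D , η-wnaf , val≈α) with η∈D Fin.zero
    ... | inj₁ η₀≈ε = trans η₀≈ε (sym (d-∈ImΦ (value Φ L (tail η) , Φv≈α)))
      where
      Φv≈α : Φ (value Φ L (tail η)) ≈ α
      Φv≈α = trans (value-tail η val≈α) (trans (∙-congˡ (⁻¹-cong η₀≈ε)) (x-ε≈x α))
    ... | inj₂ η₀∈D• = sym (d-≡mod-D• η₀∈D• α≡η₀)
      where
      tail-zeros : ∀ j → toℕ j < w′ → tail η j ≈ ε
      tail-zeros j j<w′ with η∈D (Fin.suc j)
      ... | inj₁ ηⱼ≈ε  = ηⱼ≈ε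
      ... | inj₂ ηⱼ∈D• =
        ⊥-elim (η-wnaf Fin.zero (Fin.suc j) (s≤s z≤n) (s≤s j<w′) (D•⇒≉ε η₀∈D•) (D•⇒≉ε ηⱼ∈D•))
      α≡η₀ : Cong Φ w α (η Fin.zero)
      α≡η₀ with value-∈Im-iter L w′ (tail η) tail-zeros
      ... | u , Φʷ′u≈v = u , trans (⟦⟧-cong Φʷ′u≈v) (value-tail η val≈α)

    NAF-tail : ∀ {L α} {η : Fin (suc L) → A} → IsNAFof Φ w D• (suc L) η α
               → IsNAFof Φ w D• L (tail η) (T α)
    NAF-tail {η = η} naf@(η∈D , η-wnaf , val≈α) =
        (λ j → η∈D (Fin.suc j))
      , (λ i k i<k k<i+w → η-wnaf (Fin.suc i) (Fin.suc k) (s≤s i<k) (s≤s k<i+w))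
      , sym (T-unique (trans (value-tail η val≈α) (∙-congˡ (⁻¹-cong (NAF-head≈d naf)))))

    NAF-digits : ∀ {L α} {η : Fin L → A} → IsNAFof Φ w D• L η α → ∀ k → padded L η k ≈ d (iter k T α)
    NAF-digits {zero}  {α} (_ , _ , ε≈α) k =
      sym (d-∈ImΦ (∈Im-resp (sym (iterT-ε (sym ε≈α) k)) ImΦ.ε∈Im))
    NAF-digits {suc L}     naf zero    = NAF-head≈d naf
    NAF-digits {suc L} {α} naf (suc k) =
      trans (NAF-digits (NAF-tail naf) k) (reflexive (≡.cong d (iter-suc T k α)))

    NAF⇒iterT≈ε : ∀ {L α} {η : Fin L → A} → IsNAFof Φ w D• L η α → iter L T α ≈ ε
    NAF⇒iterT≈ε {zero}      (_ , _ , ε≈α) = sym ε≈α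
    NAF⇒iterT≈ε {suc L} {α} naf =
      trans (reflexive (≡.sym (iter-suc T L α))) (NAF⇒iterT≈ε (NAF-tail naf))

    T-digits : A → (L : ℕ) → Fin L → A
    T-digits α L k = d (iter (toℕ k) T α)

    d≉ε⇒d[T¹⁺ʲ]≈ε : ∀ {β} → ¬ (d β ≈ ε) → ∀ {j} → j < w′ → d (iter (suc j) T β) ≈ ε
    d≉ε⇒d[T¹⁺ʲ]≈ε {β} dβ≉ε {j} j<w′ with d-digit β | m≤n⇒∃[o]m+o≡n j<w′
    ... | inj₁ (_ , dβ≈ε)     | _ = ⊥-elim (dβ≉ε dβ≈ε)
    ... | inj₂ (_ , _ , dβ≡β) | o , 1+j+o≡w′ =
      d-∈ImΦ (∈Im-resp (reflexive (iter-suc T j β))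
                        (∈Im-iter-suc⇒∈Im o (iterT-∈Im-iter j (suc o) Tβ∈)))
      where
      Tβ∈ : T β ∈Im iter (j + suc o) Φ
      Tβ∈ with ImΦʷ.-‿sym-∈Im dβ≡β
      ... | u , Φʷu≈β-dβ =
        u , ≡.subst (λ m → iter m Φ u ≈ T β) (≡.sym (≡.trans (+-suc j o) 1+j+o≡w′))
                    (sym (T-unique Φʷu≈β-dβ))

    T-digits-isWNAF : ∀ α L → IsWNAFWord w L (T-digits α L)
    T-digits-isWNAF α L i k i<k k<i+w dᵢ≉ε dₖ≉ε
      with m<n<m+1+o⇒∃[j]n≡1+j+m×j<o (toℕ i) (toℕ k) w′ i<k k<i+w
    ... | j , k≡1+j+i , j<w′ = dₖ≉ε (begin
      d (iter (toℕ k) T α)                         ≡⟨ ≡.cong (λ n → d (iter n T α)) k≡1+j+i ⟩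
      d (iter (suc j + toℕ i) T α)                 ≡⟨ ≡.cong d (iter-+ T (suc j) (toℕ i) α) ⟩
      d (iter (suc j) T (iter (toℕ i) T α))        ≈⟨ d≉ε⇒d[T¹⁺ʲ]≈ε dᵢ≉ε j<w′ ⟩
      ε                                            ∎)

    value-T-digits : ∀ L {α} → iter L T α ≈ ε → value Φ L (T-digits α L) ≈ α
    value-T-digits zero    ε≈α      = sym ε≈α
    value-T-digits (suc L) {α} Tᴸ⁺¹α≈ε = begin
      value Φ (suc L) (T-digits α (suc L))        ≈⟨ value-suc L (T-digits α (suc L)) ⟩
      d α ∙ Φ (value Φ L (tail (T-digits α (suc L))))
        ≈⟨ ∙-congˡ (⟦⟧-cong (value-cong L (λ j → reflexive (≡.cong d (≡.sym (iter-suc T (toℕ j) α)))))) ⟩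
      d α ∙ Φ (value Φ L (T-digits (T α) L))
        ≈⟨ ∙-congˡ (⟦⟧-cong (value-T-digits L (trans (reflexive (iter-suc T L α)) Tᴸ⁺¹α≈ε))) ⟩
      d α ∙ Φ (T α)                               ≈⟨ ∙-congˡ (T-def α) ⟩
      d α ∙ (α - d α)                             ≈⟨ x∙[y-x]≈y (d α) α ⟩
      α                                           ∎

    T-digits-isNAF : ∀ L {α} → iter L T α ≈ ε → IsNAFof Φ w D• L (T-digits α L) α
    T-digits-isNAF L {α} Tᴸα≈ε = (λ k → d-∈D _) , T-digits-isWNAF α L , value-T-digits L Tᴸα≈ε

lemma2p9 : ∀ {c ℓ p : Level} (G : AbelianGroup c ℓ)
  → let open AbelianGroup G renaming (Carrier to A) in
    let open Setup G in
    (Φ : A → A) → IsInjectiveEndo Φ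
  → (w : ℕ) → 1 ≤ w
  → (D• : A → Set p) → IsRepSystem Φ w D•
  → (d : A → A) → IsDigitMap Φ w D• d
  → (T : A → A) → IsTMap Φ d T
  → (α : A) (L : ℕ)
  → ((Σ (Fin L → A) (λ η → IsNAFof Φ w D• L η α)) ⇔ (iter L T α ≈ ε))
    × (∀ (η : Fin L → A) → IsNAFof Φ w D• L η α
         → ∀ (k : Fin L) → η k ≈ d (iter (toℕ k) T α))
    × (∀ (L′ : ℕ) (η : Fin L → A) (η′ : Fin L′ → A)
         → IsNAFof Φ w D• L η α → IsNAFof Φ w D• L′ η′ α
         → ∀ (k : ℕ) → padded L η k ≈ padded L′ η′ k)
lemma2p9 G Φ Φ-mono (suc w′) _ D• rep d d-digit T T-def α L =
    mk⇔ (λ (_ , naf) → NAF⇒iterT≈ε naf) (λ Tᴸα≈ε → T-digits α L , T-digits-isNAF L Tᴸα≈ε)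
  , (λ η naf k → trans (reflexive (≡.sym (padded-toℕ G L η k))) (NAF-digits naf (toℕ k)))
  , (λ L′ η η′ naf naf′ k → trans (NAF-digits naf k) (sym (NAF-digits naf′ k)))
  where
  open AbelianGroup G using (trans; sym; reflexive)
  open NAFExpansion G Φ Φ-mono w′ D• rep d d-digit T T-def
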